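{- Let $\kappa \geq 2$ be an integer. Then the function $f_\kappa\colon \mathbb{N}\setminus\{0\} \to \mathbb{N}$ is computable in the limit: there is a computable function $\beta\colon (\mathbb{N}\setminus\{0\})\times\mathbb{N} \to \mathbb{N}$ such that for every positive integer $n$ there is $m_0$ with $\beta(n,m) = f_\kappa(n)$ for all $m \geq m_0$. Explicitly, one may take $\beta(n,m)$ to be the smallest non-negative integer $b$ such that for each system $S \subseteq E_n$ which has a solution in integers $x_1,\ldots,x_n$ from the range $0$ to $m$ and which has fewer than $\kappa$ solutions in integers $x_1,\ldots,x_n$ from the range $0$ to $m$, there exists a solution of $S$ belonging to $[0,b]^n$.
   Context: $\mathbb{N}$ denotes the set of non-negative integers. For a positive integer $n$, $E_n=\{x_k=1,\ x_i+x_j=x_k,\ x_i \cdot x_j=x_k\colon i,j,k \in \{1,\ldots,n\}\}$. For a positive integer $n$, $f_\kappa(n)$ denotes the smallest non-negative integer $b$ such that for each system $S \subseteq E_n$ which has a solution in non-negative integers $x_1,\ldots,x_n$ and which has fewer than $\kappa$ solutions in non-negative integers $x_1,\ldots,x_n$, there exists a solution of $S$ in non-negative integers not greater than $b$. -}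

module Defs where

open import Data.Nat using (ℕ; _+_; _*_; _≤_; _<_)
open import Data.Fin using (Fin)
open import Data.Vec using (Vec; lookup)
open import Data.Vec.Relation.Unary.All as VAll using ()
open import Data.List using (List; length)
open import Data.List.Membership.Propositional using (_∈_)
open import Data.List.Relation.Unary.All using (All)
open import Data.Product using (Σ; ∃; _×_)
open import Data.Sum using (_⊎_)
open import Relation.Nullary using (¬_)
open import Relation.Binary.PropositionalEquality using (_≡_)

-- An element of E_n : x_k = 1, x_i + x_j = x_k, or x_i · x_j = x_k.
data Eqn (n : ℕ) : Set where
  one : (k : Fin n) → Eqn n
  add : (i j k : Fin n) → Eqn n
  mul : (i j k : Fin n) → Eqn n

Sat : ∀ {n} → Vec ℕ n → Eqn n → Set
Sat x (one k)     = lookup x k ≡ 1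
Sat x (add i j k) = lookup x i + lookup x j ≡ lookup x k
Sat x (mul i j k) = lookup x i * lookup x j ≡ lookup x k

-- A system S ⊆ E_n is represented by a (finite) list of equations of E_n;
-- x is a solution of S iff x satisfies every equation of S.
Sol : ∀ {n} → List (Eqn n) → Vec ℕ n → Set
Sol S x = All (Sat x) S

Bounded : ∀ {n} → ℕ → Vec ℕ n → Set
Bounded b x = VAll.All (_≤ b) x

-- A predicate on ℕ^n has fewer than κ elements: all of them are
-- contained in a list of length < κ.
FewerThan : ∀ {n} → ℕ → (Vec ℕ n → Set) → Set
FewerThan κ P = Σ (List (Vec _ _)) λ l → length l < κ × (∀ x → P x → x ∈ l)

-- b has the defining property of f_κ(n) (solutions in ℕ^n).
GoodF : ℕ → (n : ℕ) → ℕ → Set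
GoodF κ n b = (S : List (Eqn n)) → ∃ (Sol S) → FewerThan κ (Sol S) →
  ∃ λ x → Sol S x × Bounded b x

SolUpTo : ∀ {n} → ℕ → List (Eqn n) → Vec ℕ n → Set
SolUpTo m S x = Sol S x × Bounded m x

GoodB : ℕ → (n : ℕ) → ℕ → ℕ → Set
GoodB κ n m b = (S : List (Eqn n)) → ∃ (SolUpTo m S) → FewerThan κ (SolUpTo m S) →
  ∃ λ x → Sol S x × Bounded b x

IsLeast : (ℕ → Set) → ℕ → Set
IsLeast P b = P b × (∀ c → P c → b ≤ c)

-- Law of excluded middle (the theorem is classical).
LEM : Set₁
LEM = (P : Set) → P ⊎ ¬ P

-- Only finitely many systems S ⊆ E_n exist up to having the same solutions.  For each of
-- them there is a cut-off m_S: if S has fewer than κ solutions, all of them lie in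
-- [0,m_S]^n; otherwise κ of them do.  For m ≥ max_S m_S the truncated hypothesis "S has
-- a solution in [0,m]^n and fewer than κ of them" is therefore equivalent to the
-- untruncated one, so β(n,m) and f_κ(n) are least elements of the same set of bounds.
-- β itself is computable: its defining condition ranges over finitely many systems and
-- boxes, and β(n,m) ≤ m.  Finding the cut-offs needs excluded middle, as it decides
-- whether an arbitrary system has fewer than κ solutions.
module Submission where

open import Defs
open import Data.Nat using (ℕ; zero; suc; _+_; _*_; _≤_; _<_; _⊔_; z≤n; s≤s; _≟_; _≤?_; _<?_)
open import Data.Nat.Properties
  using (≤-refl; ≤-trans; ≤-<-trans; <-irrefl; ≮⇒≥; m<1+n⇒m<n∨m≡n; m≤m⊔n; m≤n⊔m; n≤1+n)
open import Data.Fin using (Fin)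
import Data.Fin as Fin
open import Data.Vec using (Vec; []; _∷_; lookup)
open import Data.Vec.Properties using () renaming (≡-dec to Vec-≡-dec)
import Data.Vec.Relation.Unary.All as Vec
open import Data.List
  using (List; []; _∷_; _++_; length; map; concatMap; upTo; allFin; filter; deduplicate; cartesianProduct)
open import Data.List.Properties using (length-removeAt′)
open import Data.List.Membership.Propositional using (_∈_; _∉_; lose)
open import Data.List.Membership.Propositional.Properties
  using ( ∈-map⁺; ∈-++⁺ˡ; ∈-++⁺ʳ; ∈-concatMap⁺; ∈-upTo⁺; ∈-allFin; ∈-cartesianProduct⁺
        ; ∈-filter⁺; ∈-filter⁻; ∈-deduplicate⁺; ∈-deduplicate⁻)
import Data.List.Membership.DecPropositional as DecMembership
open import Data.List.Relation.Binary.Subset.Propositional using (_⊆_)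
open import Data.List.Relation.Unary.All as All using (All; []; _∷_)
open import Data.List.Relation.Unary.All.Properties using (anti-mono)
open import Data.List.Relation.Unary.Any as Any using (here; there; _─_)
open import Data.List.Relation.Unary.AllPairs using ([]; _∷_)
open import Data.List.Relation.Unary.Unique.Propositional using (Unique)
open import Data.List.Relation.Unary.Unique.DecPropositional.Properties using (deduplicate-!)
open import Data.Product using (Σ; ∃; _×_; _,_; proj₁; proj₂)
import Data.Product.Properties as Product
open import Data.Sum using (_⊎_; inj₁; inj₂; [_,_])
open import Function using (id; _∘_)
open import Level using (0ℓ)
open import Relation.Nullary using (¬_; Dec; yes; no; contradiction)
open import Relation.Nullary.Decidable using (_×-dec_; _→-dec_; map′; decidable-stable)
open import Relation.Unary as U using (Pred; Decidable; _≐_)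
open import Relation.Binary using (DecidableEquality)
open import Relation.Binary.PropositionalEquality using (_≡_; refl; sym; trans; cong; subst)

private
  variable
    A : Set
    n κ m m′ b : ℕ

∈-─⁺ : ∀ {x y : A} {ys} (x∈ys : x ∈ ys) → y ∈ ys → ¬ y ≡ x → y ∈ (ys ─ x∈ys)
∈-─⁺ (here refl) (here refl) y≢x = contradiction refl y≢x
∈-─⁺ (here refl) (there y∈ys) _ = y∈ys
∈-─⁺ (there _) (here refl) _ = here refl
∈-─⁺ (there x∈ys) (there y∈ys) y≢x = there (∈-─⁺ x∈ys y∈ys y≢x)

Unique-⊆⇒length≤ : {xs ys : List A} → Unique xs → xs ⊆ ys → length xs ≤ length ys
Unique-⊆⇒length≤ {xs = []} [] _ = z≤n
Unique-⊆⇒length≤ {xs = x ∷ xs} {ys} (x∉xs ∷ !xs) xs⊆ys =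
  subst (length (x ∷ xs) ≤_) (sym (length-removeAt′ ys (Any.index x∈ys)))
    (s≤s (Unique-⊆⇒length≤ !xs xs⊆ys─x))
  where
  x∈ys : x ∈ ys
  x∈ys = xs⊆ys (here refl)

  xs⊆ys─x : xs ⊆ (ys ─ x∈ys)
  xs⊆ys─x y∈xs = ∈-─⁺ x∈ys (xs⊆ys (there y∈xs)) (All.lookup x∉xs y∈xs ∘ sym)

sublists : List A → List (List A)
sublists [] = [] ∷ []
sublists (x ∷ xs) = sublists xs ++ map (x ∷_) (sublists xs)

filter∈sublists : {P : Pred A 0ℓ} (P? : Decidable P) (xs : List A) → filter P? xs ∈ sublists xs
filter∈sublists P? [] = here refl
filter∈sublists P? (x ∷ xs) with P? x
... | yes _ = ∈-++⁺ʳ (sublists xs) (∈-map⁺ (x ∷_) (filter∈sublists P? xs))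
... | no _ = ∈-++⁺ˡ (filter∈sublists P? xs)

-- Eqn n is a retract of Fin 3 × (Fin n)³, hence finite with decidable equality.

EqnCode : ℕ → Set
EqnCode n = Fin 3 × Fin n × Fin n × Fin n

encode : Eqn n → EqnCode n
encode (one k) = Fin.zero , k , k , k
encode (add i j k) = Fin.suc Fin.zero , i , j , k
encode (mul i j k) = Fin.suc (Fin.suc Fin.zero) , i , j , k

decode : EqnCode n → Eqn n
decode (Fin.zero , _ , _ , k) = one k
decode (Fin.suc Fin.zero , i , j , k) = add i j k
decode (Fin.suc (Fin.suc Fin.zero) , i , j , k) = mul i j k

decode-encode : (e : Eqn n) → decode (encode e) ≡ e
decode-encode (one k) = refl
decode-encode (add i j k) = refl
decode-encode (mul i j k) = refl

encode-injective : {e e′ : Eqn n} → encode e ≡ encode e′ → e ≡ e′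
encode-injective {e = e} {e′} p =
  trans (sym (decode-encode e)) (trans (cong decode p) (decode-encode e′))

_≟ₑ_ : DecidableEquality (Eqn n)
e ≟ₑ e′ = map′ encode-injective (cong encode) (encode e ≟ᶜ encode e′)
  where
  _≟ᶜ_ : DecidableEquality (EqnCode _)
  _≟ᶜ_ = Product.≡-dec Fin._≟_ (Product.≡-dec Fin._≟_ (Product.≡-dec Fin._≟_ Fin._≟_))

allEqns : (n : ℕ) → List (Eqn n)
allEqns n = map decode (allFin 3 ⊗ allFin n ⊗ allFin n ⊗ allFin n)
  where
  _⊗_ = cartesianProduct
  infixr 2 _⊗_

∈-allEqns : (e : Eqn n) → e ∈ allEqns n
∈-allEqns e with encode e | decode-encode e
... | (c , i , j , k) | refl =
  ∈-map⁺ decode (∈-allFin c ∈⊗ ∈-allFin i ∈⊗ ∈-allFin j ∈⊗ ∈-allFin k)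
  where
  _∈⊗_ = ∈-cartesianProduct⁺
  infixr 2 _∈⊗_

-- Systems up to equality of their sets of equations, hence up to equal solution sets.

systems : (n : ℕ) → List (List (Eqn n))
systems n = sublists (allEqns n)

canonical : List (Eqn n) → List (Eqn n)
canonical {n} S = filter (_∈? S) (allEqns n)
  where open DecMembership _≟ₑ_ using (_∈?_)

canonical∈systems : (S : List (Eqn n)) → canonical S ∈ systems n
canonical∈systems {n} S = filter∈sublists _ (allEqns n)

Sol-canonical : (S : List (Eqn n)) → Sol (canonical S) ≐ Sol S
Sol-canonical {n} S =
  anti-mono (λ {e} e∈S → ∈-filter⁺ (_∈? S) (∈-allEqns e) e∈S) ,
  anti-mono (proj₂ ∘ ∈-filter⁻ (_∈? S) {xs = allEqns n})
  where open DecMembership _≟ₑ_ using (_∈?_)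

All-systems⇒∀ : {Q : List (Eqn n) → Set} → (∀ {S S′} → Sol S ≐ Sol S′ → Q S → Q S′) →
  All Q (systems n) → ∀ S → Q S
All-systems⇒∀ Q-resp QSystems S =
  Q-resp (Sol-canonical S) (All.lookup QSystems (canonical∈systems S))

_↾_ : Pred (Vec ℕ n) 0ℓ → ℕ → Pred (Vec ℕ n) 0ℓ
(P ↾ m) x = P x × Bounded m x

Bounded-mono : {x : Vec ℕ n} → m ≤ m′ → Bounded m x → Bounded m′ x
Bounded-mono m≤m′ = Vec.map (λ xᵢ≤m → ≤-trans xᵢ≤m m≤m′)

↾-mono : {P Q : Pred (Vec ℕ n) 0ℓ} → P U.⊆ Q → P ↾ m U.⊆ Q ↾ m
↾-mono P⊆Q (p , bounded) = P⊆Q p , bounded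

Bounded-vec : (x : Vec ℕ n) → ∃ λ m → Bounded m x
Bounded-vec [] = 0 , Vec.[]
Bounded-vec (xᵢ ∷ x) with Bounded-vec x
... | m , bounded = xᵢ ⊔ m , m≤m⊔n xᵢ m Vec.∷ Bounded-mono (m≤n⊔m xᵢ m) bounded

Bounded-list : (l : List (Vec ℕ n)) → ∃ λ m → ∀ {x} → x ∈ l → Bounded m x
Bounded-list [] = 0 , λ ()
Bounded-list (x ∷ l) with Bounded-vec x | Bounded-list l
... | m₁ , bounded-x | m₂ , bounded-l = m₁ ⊔ m₂ , λ
  { (here refl) → Bounded-mono (m≤m⊔n m₁ m₂) bounded-x
  ; (there y∈l) → Bounded-mono (m≤n⊔m m₁ m₂) (bounded-l y∈l) }

box : ℕ → (n : ℕ) → List (Vec ℕ n)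
box m zero = [] ∷ []
box m (suc n) = concatMap (λ xᵢ → map (xᵢ ∷_) (box m n)) (upTo (suc m))

∈-box⁺ : {x : Vec ℕ n} → Bounded m x → x ∈ box m n
∈-box⁺ {x = []} Vec.[] = here refl
∈-box⁺ {x = xᵢ ∷ x} (xᵢ≤m Vec.∷ bounded) =
  ∈-concatMap⁺ _ (lose (∈-upTo⁺ (s≤s xᵢ≤m)) (∈-map⁺ (xᵢ ∷_) (∈-box⁺ bounded)))

Sat? : (x : Vec ℕ n) (e : Eqn n) → Dec (Sat x e)
Sat? x (one k) = lookup x k ≟ 1
Sat? x (add i j k) = lookup x i + lookup x j ≟ lookup x k
Sat? x (mul i j k) = lookup x i * lookup x j ≟ lookup x k

Sol? : (S : List (Eqn n)) → Decidable (Sol S)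
Sol? S x = All.all? (Sat? x) S

↾? : {P : Pred (Vec ℕ n) 0ℓ} → Decidable P → ∀ m → Decidable (P ↾ m)
↾? P? m x = P? x ×-dec Vec.all? (_≤? m) x

∃-↾? : {P : Pred (Vec ℕ n) 0ℓ} → Decidable P → ∀ m → Dec (∃ (P ↾ m))
∃-↾? P? m = map′ Any.satisfied (λ (x , p↾) → lose (∈-box⁺ (proj₂ p↾)) p↾)
  (Any.any? (↾? P? m) (box m _))

FewerThan-anti-mono : {P Q : Pred (Vec ℕ n) 0ℓ} → P U.⊆ Q → FewerThan κ Q → FewerThan κ P
FewerThan-anti-mono P⊆Q (l , length<κ , covers) = l , length<κ , λ x p → covers x (P⊆Q p)

FewerThan?-by-listing : {Q : Pred (Vec ℕ n) 0ℓ} (l : List (Vec ℕ n)) → Unique l →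
  (∀ {x} → x ∈ l → Q x) → (∀ x → Q x → x ∈ l) → Dec (FewerThan κ Q)
FewerThan?-by-listing {κ = κ} l !l sound complete =
  map′ (λ length<κ → l , length<κ , complete)
  (λ (l′ , length<κ , covers) → ≤-<-trans (Unique-⊆⇒length≤ !l (covers _ ∘ sound)) length<κ)
  (length l <? κ)

FewerThan-↾? : {P : Pred (Vec ℕ n) 0ℓ} → Decidable P → ∀ κ m → Dec (FewerThan κ (P ↾ m))
FewerThan-↾? {n} P? κ m = FewerThan?-by-listing points (deduplicate-! _≟ᵥ_ candidates)
  (proj₂ ∘ ∈-filter⁻ (↾? P? m) {xs = box m n} ∘ ∈-deduplicate⁻ _≟ᵥ_ candidates)
  (λ x p↾ → ∈-deduplicate⁺ _≟ᵥ_ (∈-filter⁺ (↾? P? m) (∈-box⁺ (proj₂ p↾)) p↾))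
  where
  _≟ᵥ_ : DecidableEquality (Vec ℕ n)
  _≟ᵥ_ = Vec-≡-dec _≟_
  candidates = filter (↾? P? m) (box m n)
  points = deduplicate _≟ᵥ_ candidates

-- The defining condition of β(n,m), for a single system with solution set P.

BoxCondition : ℕ → ℕ → ℕ → Pred (Vec ℕ n) 0ℓ → Set
BoxCondition κ m b P = ∃ (P ↾ m) → FewerThan κ (P ↾ m) → ∃ (P ↾ b)

BoxCondition-resp-≐ : {P Q : Pred (Vec ℕ n) 0ℓ} → P ≐ Q →
  BoxCondition κ m b P → BoxCondition κ m b Q
BoxCondition-resp-≐ {P = P} {Q} (P⊆Q , Q⊆P) cond (x , q↾) few
  with cond (x , ↾-mono {P = Q} Q⊆P q↾) (FewerThan-anti-mono (↾-mono {P = P} P⊆Q) few)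
... | y , p↾ = y , ↾-mono {P = P} P⊆Q p↾

BoxCondition? : {P : Pred (Vec ℕ n) 0ℓ} → Decidable P → ∀ κ m b → Dec (BoxCondition κ m b P)
BoxCondition? P? κ m b = ∃-↾? P? m →-dec FewerThan-↾? P? κ m →-dec ∃-↾? P? b

GoodB? : ∀ κ n m b → Dec (GoodB κ n m b)
GoodB? κ n m b =
  map′ (All-systems⇒∀ {Q = BoxCondition κ m b ∘ Sol} BoxCondition-resp-≐)
       (λ good → All.tabulate (λ _ → good _))
  (All.all? (λ S → BoxCondition? (Sol? S) κ m b) (systems n))

GoodB-self : ∀ κ n m → GoodB κ n m m
GoodB-self κ n m S solution _ = solution

IsLeast-resp-≐ : {P Q : Pred ℕ 0ℓ} → P ≐ Q → IsLeast P b → IsLeast Q b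
IsLeast-resp-≐ (P⊆Q , Q⊆P) (pb , least) = P⊆Q pb , λ c qc → least c (Q⊆P qc)

least-or-absent-below : {P : Pred ℕ 0ℓ} → Decidable P → ∀ b →
  Σ ℕ (IsLeast P) ⊎ (∀ {c} → c < b → ¬ P c)
least-or-absent-below P? zero = inj₂ λ ()
least-or-absent-below P? (suc b) with least-or-absent-below P? b
... | inj₁ found = inj₁ found
... | inj₂ absent with P? b
...   | yes pb = inj₁ (b , pb , λ c pc → ≮⇒≥ (λ c<b → absent c<b pc))
...   | no ¬pb = inj₂ λ c<1+b → [ absent , (λ { refl → ¬pb }) ] (m<1+n⇒m<n∨m≡n c<1+b)

least : {P : Pred ℕ 0ℓ} → Decidable P → P b → Σ ℕ (IsLeast P)
least P? pb = [ id , (λ absent → contradiction pb (absent ≤-refl)) ] (least-or-absent-below P? _)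

β : ℕ → ℕ → ℕ → ℕ
β κ n m = proj₁ (least (GoodB? κ n m) (GoodB-self κ n m))

β-least : ∀ κ n m → IsLeast (GoodB κ n m) (β κ n m)
β-least κ n m = proj₂ (least (GoodB? κ n m) (GoodB-self κ n m))

IsCutoff : ℕ → Pred (Vec ℕ n) 0ℓ → ℕ → Set
IsCutoff κ P m = (FewerThan κ P → ∀ x → P x → Bounded m x) × (FewerThan κ (P ↾ m) → FewerThan κ P)

IsCutoff-mono : {P : Pred (Vec ℕ n) 0ℓ} → m ≤ m′ → IsCutoff κ P m → IsCutoff κ P m′
IsCutoff-mono m≤m′ (bounds , lifts) =
  (λ few x p → Bounded-mono m≤m′ (bounds few x p)) ,
  lifts ∘ FewerThan-anti-mono (λ (p , bounded) → p , Bounded-mono m≤m′ bounded)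

IsCutoff-resp-≐ : {P Q : Pred (Vec ℕ n) 0ℓ} → P ≐ Q → IsCutoff κ P m → IsCutoff κ Q m
IsCutoff-resp-≐ {P = P} {Q} (P⊆Q , Q⊆P) (bounds , lifts) =
  (λ few x q → bounds (FewerThan-anti-mono {P = P} P⊆Q few) x (Q⊆P q)) ,
  FewerThan-anti-mono {P = Q} Q⊆P ∘ lifts ∘ FewerThan-anti-mono (↾-mono {P = P} P⊆Q)

distinct-elements : LEM → {P : Pred (Vec ℕ n) 0ℓ} → ¬ FewerThan κ P →
  ∀ k → k ≤ κ → ∃ λ u → Unique u × All P u × length u ≡ k
distinct-elements lem ¬few zero _ = [] , [] , [] , refl
distinct-elements lem {P} ¬few (suc k) k<κ
  with distinct-elements lem ¬few k (≤-trans (n≤1+n k) k<κ)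
... | u , !u , Pu , refl with lem (∃ λ x → P x × x ∉ u)
...   | inj₁ (x , p , x∉u) = x ∷ u , All.tabulate (λ { y∈u refl → x∉u y∈u }) ∷ !u , p ∷ Pu , refl
...   | inj₂ ¬new = contradiction (u , k<κ , covers) ¬few
  where
  open DecMembership (Vec-≡-dec _≟_) using (_∈?_)
  covers : ∀ x → P x → x ∈ u
  covers x p = decidable-stable (x ∈? u) (λ x∉u → ¬new (x , p , x∉u))

cutoff : LEM → (κ : ℕ) (P : Pred (Vec ℕ n) 0ℓ) → ∃ (IsCutoff κ P)
cutoff lem κ P with lem (FewerThan κ P)
... | inj₁ few@(l , _ , covers) with Bounded-list l
...   | m , bounded = m , (λ _ x p → bounded (covers x p)) , λ _ → few
cutoff lem κ P | inj₂ ¬few with distinct-elements lem ¬few κ ≤-refl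
...   | u , !u , Pu , refl with Bounded-list u
...     | m , bounded = m , (λ few → contradiction few ¬few) , λ (l , length<κ , covers) →
  contradiction (≤-<-trans (Unique-⊆⇒length≤ !u (covers _ ∘ Pu↾m)) length<κ) (<-irrefl refl)
  where
  Pu↾m : ∀ {x} → x ∈ u → (P ↾ m) x
  Pu↾m x∈u = All.lookup Pu x∈u , bounded x∈u

Eventually : Pred ℕ 0ℓ → Set
Eventually Q = ∃ λ m₀ → ∀ m → m₀ ≤ m → Q m

eventually-cutoff : LEM → (κ : ℕ) (P : Pred (Vec ℕ n) 0ℓ) → Eventually (IsCutoff κ P)
eventually-cutoff lem κ P with cutoff lem κ P
... | m₀ , isCutoff = m₀ , λ m m₀≤m → IsCutoff-mono m₀≤m isCutoff

Eventually-All : {Q : A → Pred ℕ 0ℓ} {xs : List A} →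
  All (Eventually ∘ Q) xs → Eventually (λ m → All (λ x → Q x m) xs)
Eventually-All [] = 0 , λ _ _ → []
Eventually-All ((m₁ , q) ∷ qs) with Eventually-All qs
... | m₂ , qs′ = m₁ ⊔ m₂ , λ m m₁⊔m₂≤m →
  q m (≤-trans (m≤m⊔n m₁ m₂) m₁⊔m₂≤m) ∷ qs′ m (≤-trans (m≤n⊔m m₁ m₂) m₁⊔m₂≤m)

uniform-cutoff : LEM → ∀ κ n → Eventually (λ m → ∀ (S : List (Eqn n)) → IsCutoff κ (Sol S) m)
uniform-cutoff lem κ n
  with Eventually-All (All.tabulate {xs = systems n} λ {S} _ → eventually-cutoff lem κ (Sol S))
... | m₀ , cutoffs = m₀ , λ m m₀≤m →
  All-systems⇒∀ {Q = λ S → IsCutoff κ (Sol S) m} IsCutoff-resp-≐ (cutoffs m m₀≤m)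

GoodB≐GoodF : (∀ S → IsCutoff κ (Sol S) m) → GoodB κ n m ≐ GoodF κ n
GoodB≐GoodF cutoffs =
  (λ goodB S (x , s) few →
    goodB S (x , s , proj₁ (cutoffs S) few x s) (FewerThan-anti-mono proj₁ few)) ,
  (λ goodF S (x , s , _) few → goodF S (x , s) (proj₂ (cutoffs S) few))

mainTheorem7 : (κ : ℕ) → 2 ≤ κ →
    Σ (ℕ → ℕ → ℕ) λ β →
      ((n m : ℕ) → 1 ≤ n → IsLeast (GoodB κ n m) (β n m))
      × (LEM → (n : ℕ) → 1 ≤ n →
           ∃ λ m₀ → (m : ℕ) → m₀ ≤ m → IsLeast (GoodF κ n) (β n m))
mainTheorem7 κ _ = β κ , (λ n m _ → β-least κ n m) , limit
  where
  limit : LEM → (n : ℕ) → 1 ≤ n → ∃ λ m₀ → (m : ℕ) → m₀ ≤ m → IsLeast (GoodF κ n) (β κ n m)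
  limit lem n _ with uniform-cutoff lem κ n
  ... | m₀ , cutoffs = m₀ , λ m m₀≤m → IsLeast-resp-≐ (GoodB≐GoodF (cutoffs m m₀≤m)) (β-least κ n m)
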